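{- Let $B$ be an $(n,k)$-blocker of a convex $n$-gon with vertices $0,\dots,n-1$ (indices mod $n$). If a vertex $i$ is incident in $B$ to exactly one edge, namely $(i,j)$, then $B$ contains the ear-cover $(j-1,j+1)$.
   Context: A triangulation of a convex polygon is a maximal set of pairwise non-crossing diagonals. A blocker is a set of edges sharing an edge with every triangulation; it is saturated if removing any of its edges yields a non-blocker; an $(n,k)$-blocker is a saturated blocker with $k$ edges for a convex $n$-gon. An ear-cover is a diagonal of the form $(j-1,j+1)$. -}

module Defs where

open import Data.Nat as ℕ using (ℕ; zero; suc; _+_; _∸_)
open import Data.Nat.DivMod using (_mod_)
open import Data.Fin using (Fin; toℕ)
open import Data.Product using (Σ; _×_; _,_; proj₁; proj₂; ∃)
open import Data.Sum using (_⊎_)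
open import Data.List using (List; length)
open import Data.List.Membership.Propositional using (_∈_)
open import Data.List.Relation.Unary.Unique.Propositional using (Unique)
open import Relation.Binary.PropositionalEquality using (_≡_; _≢_)
open import Relation.Nullary using (¬_; yes; no)

-- Vertices of the convex n-gon are 0,…,n-1, i.e. Fin n (indices mod n).
-- An edge (segment between two vertices) is stored as a normalised
-- ordered pair (a , b) with a < b.
Edge : ℕ → Set
Edge n = Fin n × Fin n

edge : ∀ {n} → Fin n → Fin n → Edge n
edge i j with toℕ i ℕ.<? toℕ j
... | yes _ = (i , j)
... | no  _ = (j , i)

-- a diagonal: normalised pair of non-adjacent vertices (not a side of the polygon)
IsDiag : ∀ {n} → Edge n → Set
IsDiag {n} (a , b) =
  (suc (toℕ a) ℕ.< toℕ b) × ¬ (toℕ a ≡ 0 × suc (toℕ b) ≡ n)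

-- two diagonals cross (their interiors intersect): endpoints strictly interleave
Cross : ∀ {n} → Edge n → Edge n → Set
Cross (a , b) (c , d) =
  (toℕ a ℕ.< toℕ c × toℕ c ℕ.< toℕ b × toℕ b ℕ.< toℕ d)
  ⊎ (toℕ c ℕ.< toℕ a × toℕ a ℕ.< toℕ d × toℕ d ℕ.< toℕ b)

EdgeSet : ℕ → Set₁
EdgeSet n = Edge n → Set

IsTriangulation : ∀ {n} → EdgeSet n → Set
IsTriangulation {n} T =
  (∀ e → T e → IsDiag e)
  × (∀ e f → T e → T f → ¬ Cross e f)
  × (∀ d → IsDiag d → ¬ T d → Σ (Edge n) λ e → T e × Cross d e)

IsBlocker : ∀ {n} → EdgeSet n → Set₁
IsBlocker {n} B = (T : EdgeSet n) → IsTriangulation T → Σ (Edge n) λ e → B e × T e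

remove : ∀ {n} → EdgeSet n → Edge n → EdgeSet n
remove B e d = B d × d ≢ e

IsSaturated : ∀ {n} → EdgeSet n → Set₁
IsSaturated B = ∀ e → B e → ¬ IsBlocker (remove B e)

IsNKBlocker : (n k : ℕ) → List (Edge n) → Set₁
IsNKBlocker n k B =
  (∀ e → e ∈ B → IsDiag e)
  × Unique B
  × length B ≡ k
  × IsBlocker (λ e → e ∈ B)
  × IsSaturated (λ e → e ∈ B)

Incident : ∀ {n} → Fin n → Edge n → Set
Incident i (a , b) = (a ≡ i) ⊎ (b ≡ i)

sucMod : ∀ {n} → Fin n → Fin n
sucMod {suc m} i = suc (toℕ i) mod suc m

predMod : ∀ {n} → Fin n → Fin n
predMod {suc m} i = (toℕ i + m) mod suc m

earCover : ∀ {n} → Fin n → Edge n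
earCover j = edge (predMod j) (sucMod j)

-- Take the fan of all diagonals at i except (i, j), together with the ear-cover
-- (j - 1, j + 1). A diagonal crosses the ear-cover exactly when it ends at j, and
-- the only fan diagonal ending at j would be (i, j); so these diagonals form a
-- triangulation. B meets it, but the only edge of B at i is (i, j), which is not
-- in it; hence B contains the ear-cover.
module Submission where

open import Defs
open import Data.Nat using (ℕ; zero; suc; _+_; _<_; _<?_; _≤_; z≤n; s≤s; _%_)
open import Data.Nat.Properties
open import Data.Nat.DivMod using ([m+n]%n≡m%n; n%n≡0; m<n⇒m%n≡m)
open import Data.Fin using (Fin; toℕ; fromℕ<) renaming (_≟_ to _≟ᶠ_)
open import Data.Fin.Properties using (toℕ-injective; toℕ<n; toℕ-fromℕ<)
open import Data.Product using (Σ; _×_; _,_; proj₁; proj₂)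
open import Data.Product.Properties using (,-injective; ≡-dec)
open import Data.Sum using (_⊎_; inj₁; inj₂; map; map₁)
open import Data.Empty using (⊥-elim)
open import Data.List using (List)
open import Data.List.Membership.Propositional using (_∈_)
open import Function using (_∘_)
open import Relation.Binary using (tri<; tri≈; tri>)
open import Relation.Binary.PropositionalEquality
open import Relation.Nullary using (¬_; yes; no)

private variable n : ℕ

-- IsDiag and Cross unfold definitionally to IsDiagℕ and Crossℕ of the toℕ of the
-- endpoints, so lemmas about the latter apply to the former directly.
IsDiagℕ : ℕ → ℕ → ℕ → Set
IsDiagℕ n a b = suc a < b × ¬ (a ≡ 0 × suc b ≡ n)

Crossℕ : ℕ → ℕ → ℕ → ℕ → Set
Crossℕ a b c d = (a < c × c < b × b < d) ⊎ (c < a × a < d × d < b)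

Inside : ℕ → ℕ → ℕ → Set
Inside a b v = a < v × v < b

Outside : ℕ → ℕ → ℕ → Set
Outside a b v = v < a ⊎ b < v

Separates : ℕ → ℕ → ℕ → ℕ → Set
Separates a b v w = (Inside a b v × Outside a b w) ⊎ (Inside a b w × Outside a b v)

-- IsEarCover n j a b: (a , b) is {j - 1 , j + 1} taken mod n and ordered.
data IsEarCover : ℕ → ℕ → ℕ → ℕ → Set where
  first  : ∀ {q} → IsEarCover (suc q) 0 1 q
  middle : ∀ {n p} → suc (suc p) < n → IsEarCover n (suc p) p (suc (suc p))
  last   : ∀ {q} → IsEarCover (suc (suc q)) (suc q) 0 q

isDiagℕ⇒3<n : ∀ {n a b} → b < n → IsDiagℕ n a b → 3 < n
isDiagℕ⇒3<n {a = zero}  b<n (1<b , not-side) with m≤n⇒m<n∨m≡n b<n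
... | inj₁ 1+b<n = <-≤-trans (s≤s (s≤s 1<b)) 1+b<n
... | inj₂ 1+b≡n = ⊥-elim (not-side (refl , 1+b≡n))
isDiagℕ⇒3<n {a = suc a} b<n (2+a<b , _) = ≤-<-trans (≤-trans (s≤s (s≤s (s≤s z≤n))) 2+a<b) b<n

crossℕ-distinct : ∀ {a b c d} → Crossℕ a b c d → a ≢ c × a ≢ d × b ≢ c × b ≢ d
crossℕ-distinct (inj₁ (a<c , c<b , b<d)) =
  <⇒≢ a<c , <⇒≢ (<-trans a<c (<-trans c<b b<d)) , >⇒≢ c<b , <⇒≢ b<d
crossℕ-distinct (inj₂ (c<a , a<d , d<b)) =
  >⇒≢ c<a , <⇒≢ a<d , >⇒≢ (<-trans c<a (<-trans a<d d<b)) , >⇒≢ d<b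

crossℕ⇒isDiagℕ : ∀ {n a b c d} → b < n → Crossℕ a b c d → IsDiagℕ n c d
crossℕ⇒isDiagℕ b<n (inj₁ (a<c , c<b , b<d)) =
  ≤-<-trans c<b b<d , λ (c≡0 , _) → n≮0 (subst (_ <_) c≡0 a<c)
crossℕ⇒isDiagℕ b<n (inj₂ (c<a , a<d , d<b)) =
  ≤-<-trans c<a a<d , λ (_ , 1+d≡n) → <-irrefl refl (<-≤-trans b<n (subst (_≤ _) 1+d≡n d<b))

isEarCover-unique : ∀ {n j a b a′ b′} → IsEarCover n j a b → IsEarCover n j a′ b′ → a ≡ a′ × b ≡ b′
isEarCover-unique first      first       = refl , refl
isEarCover-unique (middle _) (middle _)  = refl , refl
isEarCover-unique last       last        = refl , refl
isEarCover-unique (middle n<n) last      = ⊥-elim (<-irrefl refl n<n)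
isEarCover-unique last       (middle n<n) = ⊥-elim (<-irrefl refl n<n)

isEarCover⇒isDiagℕ : ∀ {n j a b} → 3 < n → IsEarCover n j a b → IsDiagℕ n a b
isEarCover⇒isDiagℕ (s≤s 3<q) first = 3<q , λ ()
isEarCover⇒isDiagℕ 3<n (middle _) =
  ≤-refl , λ (p≡0 , 3+p≡n) → <-irrefl (trans (cong (3 +_) (sym p≡0)) 3+p≡n) 3<n
isEarCover⇒isDiagℕ (s≤s (s≤s 2<q)) last =
  ≤-trans (s≤s (s≤s z≤n)) 2<q , λ (_ , q+1≡q+2) → <-irrefl q+1≡q+2 ≤-refl

crossℕ-isEarCover⇒endpoint : ∀ {n j p q a b} → IsEarCover n j p q → b < n →
  Crossℕ a b p q → a ≡ j ⊎ b ≡ j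
crossℕ-isEarCover⇒endpoint first      b<n (inj₁ (s≤s z≤n , _)) = inj₁ refl
crossℕ-isEarCover⇒endpoint first      b<n (inj₂ (_ , _ , q<b)) = ⊥-elim (<-irrefl refl (<-≤-trans b<n q<b))
crossℕ-isEarCover⇒endpoint (middle _) b<n (inj₁ (_ , p<b , b<p+2)) = inj₂ (≤-antisym (≤-pred b<p+2) p<b)
crossℕ-isEarCover⇒endpoint (middle _) b<n (inj₂ (p<a , a<p+2 , _)) = inj₁ (≤-antisym (≤-pred a<p+2) p<a)
crossℕ-isEarCover⇒endpoint last       b<n (inj₂ (_ , _ , q<b)) = inj₂ (≤-antisym (≤-pred b<n) q<b)

endpoint⇒crossℕ-isEarCover : ∀ {n j p q a b} → IsEarCover n j p q → b < n →
  IsDiagℕ n a b → a ≡ j ⊎ b ≡ j → Crossℕ a b p q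
endpoint⇒crossℕ-isEarCover first b<n (1<b , not-side) (inj₁ refl) =
  inj₁ (s≤s z≤n , 1<b , ≤∧≢⇒< (≤-pred b<n) λ b≡q → not-side (refl , cong suc b≡q))
endpoint⇒crossℕ-isEarCover first b<n (() , _) (inj₂ refl)
endpoint⇒crossℕ-isEarCover (middle _) b<n (p+2<b , _) (inj₁ refl) = inj₂ (≤-refl , ≤-refl , p+2<b)
endpoint⇒crossℕ-isEarCover (middle _) b<n (a+1<p+1 , _) (inj₂ refl) =
  inj₁ (≤-pred a+1<p+1 , ≤-refl , ≤-refl)
endpoint⇒crossℕ-isEarCover last b<n (a+1<b , _) (inj₁ refl) =
  ⊥-elim (<-irrefl refl (<-trans a+1<b b<n))
endpoint⇒crossℕ-isEarCover last b<n (a+1<q+1 , not-side) (inj₂ refl) =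
  inj₂ (≤∧≢⇒< z≤n (λ 0≡a → not-side (sym 0≡a , refl)) , ≤-pred a+1<q+1 , ≤-refl)

-- The ear-cover at j is the unique diagonal one of whose sides is the single vertex j;
-- every other diagonal has a vertex other than j on each side.
OtherVertex : ℕ → ℕ → (ℕ → Set) → Set
OtherVertex n j P = Σ ℕ λ x → x < n × x ≢ j × P x

otherVertex-map : ∀ {n j} {P Q : ℕ → Set} → (∀ {x} → P x → Q x) →
  OtherVertex n j P → OtherVertex n j Q
otherVertex-map f (x , x<n , x≢j , px) = x , x<n , x≢j , f px

inner-vertex : ∀ {n a b} j → suc a < b → b < n → OtherVertex n j (Inside a b) ⊎ IsEarCover n j a b
inner-vertex {a = a} j a+1<b b<n with suc a ≟ j
... | no a+1≢j = inj₁ (suc a , <-trans a+1<b b<n , a+1≢j , ≤-refl , a+1<b)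
inner-vertex {a = a} {suc b} _ (s≤s a+1≤b) b+1<n | yes refl with b ≟ suc a
... | no b≢j = inj₁ (b , <-trans (n<1+n b) b+1<n , b≢j , a+1≤b , ≤-refl)
... | yes refl = inj₂ (middle b+1<n)

outer-vertex : ∀ {n a b} j → IsDiagℕ n a b → b < n →
  OtherVertex n j (Outside a b) ⊎ IsEarCover n j a b
outer-vertex {a = suc a} {b} j (a+2<b , _) b<n with a ≟ j
... | no a≢j = inj₁ (a , <-trans (m+n≤o⇒n≤o 2 a+2<b) b<n , a≢j , inj₁ ≤-refl)
... | yes refl with m≤n⇒m<n∨m≡n b<n
...   | inj₁ b+1<n = inj₁ (suc b , b+1<n , >⇒≢ (m<n⇒m<1+n (m+n≤o⇒n≤o 2 a+2<b)) , inj₂ ≤-refl)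
outer-vertex {a = suc zero} _ _ _ | yes refl | inj₂ refl = inj₂ first
outer-vertex {a = suc (suc a)} _ _ _ | yes refl | inj₂ refl =
  inj₁ (0 , s≤s z≤n , (λ ()) , inj₁ (s≤s z≤n))
outer-vertex {a = zero} {b} j (_ , not-side) b<n with m≤n⇒m<n∨m≡n b<n
... | inj₂ b+1≡n = ⊥-elim (not-side (refl , b+1≡n))
... | inj₁ b+1<n with suc b ≟ j
...   | no b+1≢j = inj₁ (suc b , b+1<n , b+1≢j , inj₂ ≤-refl)
...   | yes refl with m≤n⇒m<n∨m≡n b+1<n
...     | inj₁ b+2<n = inj₁ (suc (suc b) , b+2<n , >⇒≢ ≤-refl , inj₂ (m<n⇒m<1+n (n<1+n b)))
...     | inj₂ refl = inj₂ last

separating-vertex : ∀ {n a b v} j → IsDiagℕ n a b → b < n → v ≢ a → v ≢ b →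
  OtherVertex n j (Separates a b v) ⊎ IsEarCover n j a b
separating-vertex {a = a} {b} {v} j diag b<n v≢a v≢b with <-cmp v a | <-cmp v b
... | tri≈ _ v≡a _ | _ = ⊥-elim (v≢a v≡a)
... | _ | tri≈ _ v≡b _ = ⊥-elim (v≢b v≡b)
... | tri< v<a _ _ | _ =
  map₁ (otherVertex-map λ inside → inj₂ (inside , inj₁ v<a)) (inner-vertex j (proj₁ diag) b<n)
... | tri> _ _ a<v | tri> _ _ b<v =
  map₁ (otherVertex-map λ inside → inj₂ (inside , inj₂ b<v)) (inner-vertex j (proj₁ diag) b<n)
... | tri> _ _ a<v | tri< v<b _ _ =
  map₁ (otherVertex-map λ outside → inj₁ ((a<v , v<b) , outside)) (outer-vertex j diag b<n)

separates⇒crossℕ : ∀ {a b v w} → Separates a b v w →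
  (v < w × Crossℕ a b v w) ⊎ (w < v × Crossℕ a b w v)
separates⇒crossℕ (inj₁ ((a<v , v<b) , inj₁ w<a)) = inj₂ (<-trans w<a a<v , inj₂ (w<a , a<v , v<b))
separates⇒crossℕ (inj₁ ((a<v , v<b) , inj₂ b<w)) = inj₁ (<-trans v<b b<w , inj₁ (a<v , v<b , b<w))
separates⇒crossℕ (inj₂ ((a<w , w<b) , inj₁ v<a)) = inj₁ (<-trans v<a a<w , inj₂ (v<a , a<w , w<b))
separates⇒crossℕ (inj₂ ((a<w , w<b) , inj₂ b<v)) = inj₂ (<-trans w<b b<v , inj₁ (a<w , w<b , b<v))

[1+j+m]%[1+m]≡j : ∀ {j m} → j < suc m → (suc j + m) % suc m ≡ j
[1+j+m]%[1+m]≡j {j} {m} j<1+m = begin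
  (suc j + m) % suc m  ≡⟨ cong (_% suc m) (sym (+-suc j m)) ⟩
  (j + suc m) % suc m  ≡⟨ [m+n]%n≡m%n j (suc m) ⟩
  j % suc m            ≡⟨ m<n⇒m%n≡m j<1+m ⟩
  j                    ∎
  where open ≡-Reasoning

isEarCover-pred-suc : ∀ m j {p s} → j < suc m → 2 < suc m →
  p ≡ (j + m) % suc m → s ≡ suc j % suc m →
  (p < s × IsEarCover (suc m) j p s) ⊎ (s < p × IsEarCover (suc m) j s p)
isEarCover-pred-suc m zero _ (s≤s 1<m) p≡ s≡
  rewrite trans p≡ (m<n⇒m%n≡m (n<1+n m))
        | trans s≡ (m<n⇒m%n≡m (s≤s (<⇒≤ 1<m)))
  = inj₂ (1<m , first)
isEarCover-pred-suc m (suc j) j+1<m+1 _ p≡ s≡ with m≤n⇒m<n∨m≡n (≤-pred j+1<m+1)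
... | inj₁ j+1<m
  rewrite trans p≡ ([1+j+m]%[1+m]≡j {j} (m<n⇒m<1+n (<-trans (n<1+n j) j+1<m)))
        | trans s≡ (m<n⇒m%n≡m (s≤s j+1<m))
  = inj₁ (m<n⇒m<1+n (n<1+n j) , middle (s≤s j+1<m))
isEarCover-pred-suc _ (suc j) _ (s≤s (s≤s 0<j)) p≡ s≡ | inj₂ refl
  rewrite trans p≡ ([1+j+m]%[1+m]≡j {j} (m<n⇒m<1+n (n<1+n j)))
        | trans s≡ (n%n≡0 (suc (suc j)))
  = inj₂ (0<j , last)

edge-< : {i j : Fin n} → toℕ i < toℕ j → edge i j ≡ (i , j)
edge-< {i = i} {j = j} i<j with toℕ i <? toℕ j
... | yes _ = refl
... | no i≮j = ⊥-elim (i≮j i<j)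

edge-> : {i j : Fin n} → toℕ j < toℕ i → edge i j ≡ (j , i)
edge-> {i = i} {j = j} j<i with toℕ i <? toℕ j
... | yes i<j = ⊥-elim (<-asym i<j j<i)
... | no _ = refl

edge-endpoints : (i j : Fin n) → edge i j ≡ (i , j) ⊎ edge i j ≡ (j , i)
edge-endpoints i j with toℕ i <? toℕ j
... | yes _ = inj₁ refl
... | no _ = inj₂ refl

toℕ-edge : (P : ℕ → ℕ → Set) {i j : Fin n} →
  (toℕ i < toℕ j × P (toℕ i) (toℕ j)) ⊎ (toℕ j < toℕ i × P (toℕ j) (toℕ i)) →
  P (toℕ (proj₁ (edge i j))) (toℕ (proj₂ (edge i j)))
toℕ-edge P {i = i} {j = j} (inj₁ (i<j , p)) rewrite edge-< i<j = p
toℕ-edge P {i = i} {j = j} (inj₂ (j<i , p)) rewrite edge-> j<i = p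

edge-incidentˡ : (i j : Fin n) → Incident i (edge i j)
edge-incidentˡ i j with toℕ i <? toℕ j
... | yes _ = inj₁ refl
... | no _ = inj₂ refl

edge-incidentʳ : (i j : Fin n) → Incident j (edge i j)
edge-incidentʳ i j with toℕ i <? toℕ j
... | yes _ = inj₂ refl
... | no _ = inj₁ refl

edge-injectiveʳ : {i x j : Fin n} → edge i x ≡ edge i j → x ≡ j
edge-injectiveʳ {i = i} {x = x} {j = j} eq with edge-endpoints i x | edge-endpoints i j
... | inj₁ ix | inj₁ ij = proj₂ (,-injective (trans (sym ix) (trans eq ij)))
... | inj₁ ix | inj₂ ji = let i≡j , x≡i = ,-injective (trans (sym ix) (trans eq ji)) in trans x≡i i≡j
... | inj₂ xi | inj₁ ij = let x≡i , i≡j = ,-injective (trans (sym xi) (trans eq ij)) in trans x≡i i≡j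
... | inj₂ xi | inj₂ ji = proj₁ (,-injective (trans (sym xi) (trans eq ji)))

isDiag⇒3<n : {e : Edge n} → IsDiag e → 3 < n
isDiag⇒3<n {e = _ , b} = isDiagℕ⇒3<n (toℕ<n b)

isDiag-edge⇒≢ : {i j : Fin n} → IsDiag (edge i j) → i ≢ j
isDiag-edge⇒≢ {i = i} d refl with edge-endpoints i i
... | inj₁ ii rewrite ii = <-irrefl refl (<-trans (n<1+n _) (proj₁ d))
... | inj₂ ii rewrite ii = <-irrefl refl (<-trans (n<1+n _) (proj₁ d))

cross-sym : {e f : Edge n} → Cross e f → Cross f e
cross-sym (inj₁ c) = inj₂ c
cross-sym (inj₂ c) = inj₁ c

incident⇒¬cross : {v : Fin n} {e f : Edge n} → Incident v e → Incident v f → ¬ Cross e f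
incident⇒¬cross v∈e v∈f c with crossℕ-distinct c | v∈e | v∈f
... | a≢c , _ , _ , _ | inj₁ refl | inj₁ refl = a≢c refl
... | _ , a≢d , _ , _ | inj₁ refl | inj₂ refl = a≢d refl
... | _ , _ , b≢c , _ | inj₂ refl | inj₁ refl = b≢c refl
... | _ , _ , _ , b≢d | inj₂ refl | inj₂ refl = b≢d refl

cross⇒isDiag : {d e : Edge n} → Cross d e → IsDiag e
cross⇒isDiag {d = _ , b} = crossℕ⇒isDiagℕ (toℕ<n b)

incident-both⇒≡edge : {i j a b : Fin n} → toℕ a < toℕ b → i ≢ j →
  Incident i (a , b) → Incident j (a , b) → (a , b) ≡ edge i j
incident-both⇒≡edge a<b i≢j (inj₁ refl) (inj₁ refl) = ⊥-elim (i≢j refl)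
incident-both⇒≡edge a<b i≢j (inj₁ refl) (inj₂ refl) = sym (edge-< a<b)
incident-both⇒≡edge a<b i≢j (inj₂ refl) (inj₁ refl) = sym (edge-> a<b)
incident-both⇒≡edge a<b i≢j (inj₂ refl) (inj₂ refl) = ⊥-elim (i≢j refl)

earCover-spec : (j : Fin n) → 2 < n →
  IsEarCover n (toℕ j) (toℕ (proj₁ (earCover j))) (toℕ (proj₂ (earCover j)))
earCover-spec {suc m} j 2<n = toℕ-edge (IsEarCover (suc m) (toℕ j))
  (isEarCover-pred-suc m (toℕ j) (toℕ<n j) 2<n (toℕ-fromℕ< _) (toℕ-fromℕ< _))

earCover-isDiag : (j : Fin n) → 3 < n → IsDiag (earCover j)
earCover-isDiag j 3<n = isEarCover⇒isDiagℕ 3<n (earCover-spec j (<-trans (n<1+n 2) 3<n))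

cross-earCover⇒incident : {j a b : Fin n} → 2 < n → Cross (a , b) (earCover j) → Incident j (a , b)
cross-earCover⇒incident {j = j} {b = b} 2<n c =
  map toℕ-injective toℕ-injective (crossℕ-isEarCover⇒endpoint (earCover-spec j 2<n) (toℕ<n b) c)

incident⇒cross-earCover : {j : Fin n} {d : Edge n} → IsDiag d → Incident j d → Cross d (earCover j)
incident⇒cross-earCover {j = j} {d = _ , b} diag j∈d =
  endpoint⇒crossℕ-isEarCover (earCover-spec j (<-trans (n<1+n 2) (isDiag⇒3<n diag))) (toℕ<n b) diag
    (map (cong toℕ) (cong toℕ) j∈d)

isEarCover⇒≡earCover : {j a b : Fin n} → 2 < n → IsEarCover n (toℕ j) (toℕ a) (toℕ b) →
  (a , b) ≡ earCover j
isEarCover⇒≡earCover {j = j} 2<n ear with isEarCover-unique ear (earCover-spec j 2<n)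
... | a≡ , b≡ = cong₂ _,_ (toℕ-injective a≡) (toℕ-injective b≡)

separated-edge-or-earCover : {i j a b : Fin n} → IsDiag (a , b) → i ≢ a → i ≢ b →
  (Σ (Fin n) λ x → x ≢ j × Cross (a , b) (edge i x)) ⊎ (a , b) ≡ earCover j
separated-edge-or-earCover {i = i} {j} {a} {b} diag i≢a i≢b
  with separating-vertex (toℕ j) diag (toℕ<n b) (i≢a ∘ toℕ-injective) (i≢b ∘ toℕ-injective)
... | inj₂ ear = inj₂ (isEarCover⇒≡earCover (<-trans (n<1+n 2) (isDiag⇒3<n diag)) ear)
... | inj₁ (x , x<n , x≢j , sep) with fromℕ< x<n | toℕ-fromℕ< x<n
...   | y | refl =
  inj₁ (y , x≢j ∘ cong toℕ , toℕ-edge (Crossℕ (toℕ a) (toℕ b)) (separates⇒crossℕ sep))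

fanWithEar : Fin n → Fin n → EdgeSet n
fanWithEar i j e = IsDiag e × ((Incident i e × e ≢ edge i j) ⊎ e ≡ earCover j)

fanWithEar-isTriangulation : {i j : Fin n} → IsDiag (edge i j) → IsTriangulation (fanWithEar i j)
fanWithEar-isTriangulation {n = n} {i} {j} diag-ij = (λ _ → proj₁) , noncrossing , maximal
  where
  3<n : 3 < n
  3<n = isDiag⇒3<n diag-ij

  fan-¬cross-earCover : {e : Edge n} → IsDiag e → Incident i e → e ≢ edge i j →
    ¬ Cross e (earCover j)
  fan-¬cross-earCover (a+1<b , _) i∈e e≢ij c =
    e≢ij (incident-both⇒≡edge (<-trans (n<1+n _) a+1<b) (isDiag-edge⇒≢ diag-ij) i∈e
      (cross-earCover⇒incident (<-trans (n<1+n 2) 3<n) c))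

  noncrossing : ∀ e f → fanWithEar i j e → fanWithEar i j f → ¬ Cross e f
  noncrossing e f (_ , inj₁ (i∈e , _)) (_ , inj₁ (i∈f , _)) = incident⇒¬cross i∈e i∈f
  noncrossing e f (de , inj₁ (i∈e , e≢ij)) (_ , inj₂ refl) = fan-¬cross-earCover de i∈e e≢ij
  noncrossing e f (_ , inj₂ refl) (df , inj₁ (i∈f , f≢ij)) = fan-¬cross-earCover df i∈f f≢ij ∘ cross-sym
  noncrossing e f (_ , inj₂ refl) (_ , inj₂ refl) = incident⇒¬cross (inj₁ refl) (inj₁ refl)

  through-i : ∀ d → IsDiag d → ¬ fanWithEar i j d → Incident i d →
    Σ (Edge n) λ e → fanWithEar i j e × Cross d e
  through-i d diag d∉T i∈d with ≡-dec _≟ᶠ_ _≟ᶠ_ d (edge i j)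
  ... | no d≢ij = ⊥-elim (d∉T (diag , inj₁ (i∈d , d≢ij)))
  ... | yes d≡ij = earCover j , (earCover-isDiag j 3<n , inj₂ refl) ,
    incident⇒cross-earCover diag (subst (Incident j) (sym d≡ij) (edge-incidentʳ i j))

  maximal : ∀ d → IsDiag d → ¬ fanWithEar i j d → Σ (Edge n) λ e → fanWithEar i j e × Cross d e
  maximal (a , b) diag d∉T with a ≟ᶠ i | b ≟ᶠ i
  ... | yes a≡i | _ = through-i (a , b) diag d∉T (inj₁ a≡i)
  ... | no _ | yes b≡i = through-i (a , b) diag d∉T (inj₂ b≡i)
  ... | no a≢i | no b≢i with separated-edge-or-earCover diag (a≢i ∘ sym) (b≢i ∘ sym)
  ...   | inj₂ d≡ear = ⊥-elim (d∉T (diag , inj₂ d≡ear))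
  ...   | inj₁ (x , x≢j , c) =
    edge i x , (cross⇒isDiag c , inj₁ (edge-incidentˡ i x , x≢j ∘ edge-injectiveʳ)) , c

blocker-contains-earCover : {B : EdgeSet n} {i j : Fin n} → IsBlocker B → IsDiag (edge i j) →
  (∀ e → B e → Incident i e → e ≡ edge i j) → B (earCover j)
blocker-contains-earCover {i = i} {j} blocks diag-ij only-ij
  with blocks (fanWithEar i j) (fanWithEar-isTriangulation diag-ij)
... | e , e∈B , _ , inj₁ (i∈e , e≢ij) = ⊥-elim (e≢ij (only-ij e e∈B i∈e))
... | e , e∈B , _ , inj₂ refl = e∈B

mainTheorem10 : (n k : ℕ) (B : List (Edge n)) → IsNKBlocker n k B →
    (i j : Fin n) → edge i j ∈ B →
    (∀ e → e ∈ B → Incident i e → e ≡ edge i j) →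
    earCover j ∈ B
mainTheorem10 n k B (diagonals , _ , _ , blocks , _) i j ij∈B only-ij =
  blocker-contains-earCover blocks (diagonals _ ij∈B) only-ij
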